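{- Let $k,r,s,t\in\mathbb{N}$ with $k+rs\ge t\ge k$. Then $S_{k,r,s}$ does not contain a subgraph on $t$ vertices with more than $$f(k,s,t)=\binom{k}{2}+k(t-k)+\left\lfloor\frac{t-k}{s}\right\rfloor\binom{s}{2}+\binom{t-k-\left\lfloor\frac{t-k}{s}\right\rfloor s}{2}$$ edges.
   Context: All graphs are finite and simple. For $k,r,s\in\mathbb{N}$, $S_{k,r,s}$ is the graph whose vertex set is the disjoint union of sets $C,A_1,\dots,A_r$ with $|C|=k$ and $|A_i|=s$ for all $i$, in which $C$ and each $A_i$ induce cliques, every vertex of $C$ is adjacent to every other vertex of the graph, and there are no edges between $A_i$ and $A_j$ for $i\ne j$. -}

module Defs where

open import Data.Nat using (ℕ; zero; suc; _+_; _*_; _∸_; _/_; _<_)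
open import Data.Nat.Combinatorics using (_C_)
open import Data.Fin using (Fin; toℕ)
open import Data.Nat.Properties using (_<?_)
open import Data.Unit using (⊤)
open import Data.Product using (_×_; _,_; Σ; proj₁; proj₂)
open import Data.Sum using (_⊎_; inj₁; inj₂)
open import Data.Bool using (Bool; true; false)
import Data.Bool.Properties
open import Data.List using (List; length; filter; allFin; concatMap; map)
open import Relation.Binary.PropositionalEquality using (_≡_)
open import Relation.Nullary using (¬_; Dec; yes; no)
open import Function.Definitions using (Injective)

record Graph (n : ℕ) : Set where
  field
    adj   : Fin n → Fin n → Bool
    sym   : ∀ u v → adj u v ≡ adj v u
    irrefl : ∀ v → adj v v ≡ false

open Graph public

pairsLT : (n : ℕ) → List (Fin n × Fin n)
pairsLT n = filter (λ p → lt (proj₁ p) (proj₂ p))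
                   (concatMap (λ i → map (λ j → (i , j)) (allFin n)) (allFin n))
  where
  lt : (i j : Fin n) → Dec (toℕ i < toℕ j)
  lt i j = toℕ i <? toℕ j

edgeCount : {n : ℕ} → Graph n → ℕ
edgeCount {n} G = length (filter (λ p → adj G (proj₁ p) (proj₂ p) Data.Bool.Properties.≟ true) (pairsLT n))

-- Vertices of S_{k,r,s}: C = Fin k, A_i = {i} × Fin s for i : Fin r.
SVert : ℕ → ℕ → ℕ → Set
SVert k r s = Fin k ⊎ (Fin r × Fin s)

SAdj : {k r s : ℕ} → SVert k r s → SVert k r s → Set
SAdj (inj₁ c) (inj₁ c') = ¬ (c ≡ c')
SAdj (inj₁ c) (inj₂ _) = ⊤
SAdj (inj₂ _) (inj₁ c) = ⊤
SAdj (inj₂ (i , a)) (inj₂ (j , b)) = (i ≡ j) × ¬ (a ≡ b)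

IsSubgraphOfS : (k r s : ℕ) {t : ℕ} → Graph t → Set
IsSubgraphOfS k r s {t} H =
  Σ (Fin t → SVert k r s) λ φ →
    Injective _≡_ _≡_ φ × (∀ u v → adj H u v ≡ true → SAdj (φ u) (φ v))

-- f(k,s,t) = C(k,2) + k(t-k) + ⌊(t-k)/s⌋ C(s,2) + C(t-k-⌊(t-k)/s⌋ s, 2),
-- with ⌊x/0⌋ = 0 (Agda convention; for s = 0 one needs t = k anyway).
fkst : ℕ → ℕ → ℕ → ℕ
fkst k s t = k C 2 + k * (t ∸ k) + q * (s C 2) + ((t ∸ k) ∸ q * s) C 2
  where
  q : ℕ
  q = div (t ∸ k) s
    where
    div : ℕ → ℕ → ℕ
    div m zero = zero
    div m (suc n) = m / suc n

{-# OPTIONS --safe #-}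
module Submission where

-- Embed H into S_{k,r,s} and let a vertices land in the clique C and b_i in A_i.
-- Counting, for each vertex, its neighbours among the later vertices gives at most
-- C(a,2) + a·Σ b_i + Σ C(b_i,2) edges.  Since b_i ≤ s and C(·,2) is convex, the
-- last sum is at most the value obtained by packing the Σ b_i part vertices greedily
-- into blocks of size s.  Finally, moving one vertex from the parts into the core
-- never decreases the resulting bound, and a ≤ k by injectivity, so a = k is the
-- worst case, which is f(k,s,t).

open import Defs hiding (sym)
open import Data.Nat using (ℕ; zero; suc; _+_; _*_; _∸_; _/_; _≤_; _<_; z≤n; z<s; NonZero; >-nonZero⁻¹)
open import Data.Nat.Properties
open import Data.Nat.DivMod using (m<n⇒m/n≡0; m*n/n≡m; +-distrib-/-∣ʳ; _divMod_; result)
open import Data.Nat.Divisibility using (n∣m*n)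
open import Data.Nat.Combinatorics using (_C_; nCk+nC[k+1]≡[n+1]C[k+1]; nC1≡n)
open import Data.Nat.Solver using (module +-*-Solver)
open import Data.Bool using (Bool; true; false; _∧_)
import Data.Bool.Properties as Bool
open import Data.Fin using (Fin; zero; suc; toℕ)
import Data.Fin.Properties as Fin
open import Data.List using (List; []; _∷_; _++_; length; filter; map; concat; tabulate; allFin)
open import Data.List.Properties using (map-tabulate)
open import Data.Product using (_×_; _,_)
open import Data.Sum using (inj₁; inj₂)
open import Data.Vec.Functional using (Vector)
open import Function using (_∘_; id)
open import Function.Definitions using (Injective)
open import Relation.Binary.PropositionalEquality
open import Relation.Nullary using (yes; no; does; contradiction)
open import Relation.Unary using (Decidable)
open import Algebra.Properties.Semiring.Sum +-*-semiring
  using (sum; sum-syntax; sum-cong-≗; sum-replicate-zero; ∑-distrib-+; ∑-comm; *-distribˡ-sum)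

open +-*-Solver

choose2 : ℕ → ℕ
choose2 zero    = 0
choose2 (suc n) = n + choose2 n

C2≡choose2 : ∀ n → n C 2 ≡ choose2 n
C2≡choose2 zero    = refl
C2≡choose2 (suc n) = begin
  suc n C 2      ≡⟨ nCk+nC[k+1]≡[n+1]C[k+1] n 1 ⟨
  n C 1 + n C 2  ≡⟨ cong₂ _+_ (nC1≡n n) (C2≡choose2 n) ⟩
  n + choose2 n  ∎
  where open ≡-Reasoning

choose2-+ : ∀ m n → choose2 (m + n) ≡ choose2 m + choose2 n + m * n
choose2-+ zero    n = sym (+-identityʳ (choose2 n))
choose2-+ (suc m) n = begin
  m + n + choose2 (m + n)                  ≡⟨ cong (m + n +_) (choose2-+ m n) ⟩
  m + n + (choose2 m + choose2 n + m * n)  ≡⟨ solve 5 (λ m n a b c → m :+ n :+ (a :+ b :+ c) := m :+ a :+ b :+ (n :+ c))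
                                                refl m n (choose2 m) (choose2 n) (m * n) ⟩
  m + choose2 m + choose2 n + (n + m * n)  ∎
  where open ≡-Reasoning

choose2-exchange : ∀ {x y} u → x ≤ y → choose2 (u + x) + choose2 y ≤ choose2 x + choose2 (y + u)
choose2-exchange {x} {y} u x≤y = begin
  choose2 (u + x) + choose2 y                  ≡⟨ cong (λ z → choose2 z + choose2 y) (+-comm u x) ⟩
  choose2 (x + u) + choose2 y                  ≡⟨ cong (_+ choose2 y) (choose2-+ x u) ⟩
  choose2 x + choose2 u + x * u + choose2 y    ≤⟨ +-monoˡ-≤ (choose2 y) (+-monoʳ-≤ (choose2 x + choose2 u) (*-monoˡ-≤ u x≤y)) ⟩
  choose2 x + choose2 u + y * u + choose2 y    ≡⟨ solve 4 (λ a b c d → a :+ b :+ c :+ d := a :+ (d :+ b :+ c))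
                                                    refl (choose2 x) (choose2 u) (y * u) (choose2 y) ⟩
  choose2 x + (choose2 y + choose2 u + y * u)  ≡⟨ cong (choose2 x +_) (choose2-+ y u) ⟨
  choose2 x + choose2 (y + u)                  ∎
  where open ≤-Reasoning

-- The number of pairs inside blocks when m points are packed into blocks of size s,
-- all full but the last.  The clause for s = 0 matches the convention ⌊m/0⌋ = 0 of fkst.
packedPairs : ℕ → ℕ → ℕ
packedPairs zero      m = choose2 m
packedPairs s@(suc _) m = (m / s) * choose2 s + choose2 (m ∸ (m / s) * s)

packedPairs-divMod< : ∀ {s} .{{_ : NonZero s}} ρ q → ρ < s →
                      packedPairs s (ρ + q * s) ≡ q * choose2 s + choose2 ρ
packedPairs-divMod< {s@(suc _)} ρ q ρ<s = begin
  ((ρ + q * s) / s) * choose2 s + choose2 (ρ + q * s ∸ ((ρ + q * s) / s) * s)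
    ≡⟨ cong (λ d → d * choose2 s + choose2 (ρ + q * s ∸ d * s)) quotient ⟩
  q * choose2 s + choose2 (ρ + q * s ∸ q * s)
    ≡⟨ cong (λ x → q * choose2 s + choose2 x) (m+n∸n≡m ρ (q * s)) ⟩
  q * choose2 s + choose2 ρ
    ∎
  where
  open ≡-Reasoning
  quotient : (ρ + q * s) / s ≡ q
  quotient = trans (+-distrib-/-∣ʳ ρ (n∣m*n q)) (cong₂ _+_ (m<n⇒m/n≡0 ρ<s) (m*n/n≡m q s))

packedPairs-divMod : ∀ {s} .{{_ : NonZero s}} ρ q → ρ ≤ s →
                     packedPairs s (ρ + q * s) ≡ q * choose2 s + choose2 ρ
packedPairs-divMod ρ q ρ≤s with m≤n⇒m<n∨m≡n ρ≤s
... | inj₁ ρ<s  = packedPairs-divMod< ρ q ρ<s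
... | inj₂ refl = begin
  packedPairs ρ (ρ + q * ρ)  ≡⟨ packedPairs-divMod< 0 (suc q) (>-nonZero⁻¹ ρ) ⟩
  suc q * choose2 ρ + 0      ≡⟨ solve 2 (λ q c → (con 1 :+ q) :* c :+ con 0 := q :* c :+ c) refl q (choose2 ρ) ⟩
  q * choose2 ρ + choose2 ρ  ∎
  where open ≡-Reasoning

packedPairs-suc≤ : ∀ s m → packedPairs s (suc m) ≤ packedPairs s m + m
packedPairs-suc≤ zero      m = ≤-reflexive (+-comm m (choose2 m))
packedPairs-suc≤ s@(suc _) m with m divMod s
... | result q ρ refl = begin
  packedPairs s (suc r + q * s)            ≡⟨ packedPairs-divMod (suc r) q (Fin.toℕ<n ρ) ⟩
  q * choose2 s + (r + choose2 r)          ≡⟨ solve 3 (λ a r c → a :+ (r :+ c) := a :+ c :+ r) refl (q * choose2 s) r (choose2 r) ⟩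
  q * choose2 s + choose2 r + r            ≤⟨ +-monoʳ-≤ (q * choose2 s + choose2 r) (m≤m+n r (q * s)) ⟩
  q * choose2 s + choose2 r + (r + q * s)  ≡⟨ cong (_+ (r + q * s)) (packedPairs-divMod r q (<⇒≤ (Fin.toℕ<n ρ))) ⟨
  packedPairs s (r + q * s) + (r + q * s)  ∎
  where
  open ≤-Reasoning
  r : ℕ
  r = toℕ ρ

choose2+packedPairs≤-fits : ∀ {s} .{{_ : NonZero s}} ρ q b → ρ + b ≤ s →
                            choose2 b + packedPairs s (ρ + q * s) ≤ packedPairs s (b + (ρ + q * s))
choose2+packedPairs≤-fits {s} ρ q b ρ+b≤s = begin
  choose2 b + packedPairs s (ρ + q * s)            ≡⟨ cong (choose2 b +_) (packedPairs-divMod ρ q (m+n≤o⇒m≤o ρ ρ+b≤s)) ⟩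
  choose2 b + (q * choose2 s + choose2 ρ)          ≡⟨ solve 3 (λ c a d → c :+ (a :+ d) := a :+ (d :+ c)) refl (choose2 b) (q * choose2 s) (choose2 ρ) ⟩
  q * choose2 s + (choose2 ρ + choose2 b)          ≤⟨ +-monoʳ-≤ (q * choose2 s) (m≤m+n (choose2 ρ + choose2 b) (ρ * b)) ⟩
  q * choose2 s + (choose2 ρ + choose2 b + ρ * b)  ≡⟨ cong (q * choose2 s +_) (choose2-+ ρ b) ⟨
  q * choose2 s + choose2 (ρ + b)                  ≡⟨ packedPairs-divMod (ρ + b) q ρ+b≤s ⟨
  packedPairs s (ρ + b + q * s)                    ≡⟨ cong (packedPairs s) (solve 3 (λ ρ b x → ρ :+ b :+ x := b :+ (ρ :+ x)) refl ρ b (q * s)) ⟩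
  packedPairs s (b + (ρ + q * s))                  ∎
  where open ≤-Reasoning

-- The u + r new points fill the partial block of size ρ up to s = ρ + u and open a new
-- block of size r; choose2-exchange moves u of them into the partial block.
choose2+packedPairs≤-overflows : ∀ ρ u r q .{{_ : NonZero (ρ + u)}} → r ≤ ρ →
  choose2 (u + r) + packedPairs (ρ + u) (ρ + q * (ρ + u)) ≤ packedPairs (ρ + u) (u + r + (ρ + q * (ρ + u)))
choose2+packedPairs≤-overflows ρ u r q r≤ρ = begin
  choose2 (u + r) + packedPairs s (ρ + q * s)    ≡⟨ cong (choose2 (u + r) +_) (packedPairs-divMod ρ q (m≤m+n ρ u)) ⟩
  choose2 (u + r) + (q * choose2 s + choose2 ρ)  ≡⟨ solve 3 (λ a x y → a :+ (x :+ y) := a :+ y :+ x) refl (choose2 (u + r)) (q * choose2 s) (choose2 ρ) ⟩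
  choose2 (u + r) + choose2 ρ + q * choose2 s    ≤⟨ +-monoˡ-≤ (q * choose2 s) (choose2-exchange u r≤ρ) ⟩
  choose2 r + choose2 s + q * choose2 s          ≡⟨ solve 3 (λ a x q → a :+ x :+ q :* x := (con 1 :+ q) :* x :+ a) refl (choose2 r) (choose2 s) q ⟩
  suc q * choose2 s + choose2 r                  ≡⟨ packedPairs-divMod r (suc q) (≤-trans r≤ρ (m≤m+n ρ u)) ⟨
  packedPairs s (r + suc q * s)                  ≡⟨ cong (packedPairs s) (solve 4 (λ ρ u r x → r :+ (ρ :+ u :+ x) := u :+ r :+ (ρ :+ x)) refl ρ u r (q * s)) ⟩
  packedPairs s (u + r + (ρ + q * s))            ∎
  where
  open ≤-Reasoning
  s : ℕ
  s = ρ + u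

choose2+packedPairs≤-divMod : ∀ {s} .{{_ : NonZero s}} ρ q b → ρ ≤ s → b ≤ s →
                              choose2 b + packedPairs s (ρ + q * s) ≤ packedPairs s (b + (ρ + q * s))
choose2+packedPairs≤-divMod ρ q b ρ≤s b≤s with m≤n⇒∃[o]m+o≡n ρ≤s
... | u , refl with b ≤? u
...   | yes b≤u = choose2+packedPairs≤-fits ρ q b (+-monoʳ-≤ ρ b≤u)
...   | no b≰u with m≤n⇒∃[o]m+o≡n (<⇒≤ (≰⇒> b≰u))
...     | r , refl = choose2+packedPairs≤-overflows ρ u r q (+-cancelˡ-≤ u r ρ (≤-trans b≤s (≤-reflexive (+-comm ρ u))))

choose2+packedPairs≤ : ∀ s b m → b ≤ s → choose2 b + packedPairs s m ≤ packedPairs s (b + m)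
choose2+packedPairs≤ zero      .0 m z≤n = ≤-refl
choose2+packedPairs≤ s@(suc _) b  m b≤s with m divMod s
... | result q ρ refl = choose2+packedPairs≤-divMod (toℕ ρ) q b (<⇒≤ (Fin.toℕ<n ρ)) b≤s

∑choose2≤packedPairs : ∀ s {r} (b : Vector ℕ r) → (∀ i → b i ≤ s) → ∑[ i < r ] choose2 (b i) ≤ packedPairs s (sum b)
∑choose2≤packedPairs s {zero}  b b≤s = z≤n
∑choose2≤packedPairs s {suc r} b b≤s =
  ≤-trans (+-monoʳ-≤ (choose2 (b zero)) (∑choose2≤packedPairs s (b ∘ suc) (b≤s ∘ suc)))
          (choose2+packedPairs≤ s (b zero) _ (b≤s zero))

maxEdges : ℕ → ℕ → ℕ → ℕ
maxEdges s c m = choose2 c + c * m + packedPairs s m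

maxEdges-suc : ∀ s c m → maxEdges s c (suc m) ≤ maxEdges s (suc c) m
maxEdges-suc s c m = begin
  choose2 c + c * suc m + packedPairs s (suc m)    ≤⟨ +-monoʳ-≤ (choose2 c + c * suc m) (packedPairs-suc≤ s m) ⟩
  choose2 c + c * suc m + (packedPairs s m + m)    ≡⟨ cong (λ x → choose2 c + x + (packedPairs s m + m)) (*-suc c m) ⟩
  choose2 c + (c + c * m) + (packedPairs s m + m)  ≡⟨ solve 5 (λ a c cm g m → a :+ (c :+ cm) :+ (g :+ m) := c :+ a :+ (m :+ cm) :+ g)
                                                        refl (choose2 c) c (c * m) (packedPairs s m) m ⟩
  choose2 (suc c) + suc c * m + packedPairs s m    ∎
  where open ≤-Reasoning

maxEdges-shift : ∀ s c d m → maxEdges s c (d + m) ≤ maxEdges s (d + c) m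
maxEdges-shift s c zero    m = ≤-refl
maxEdges-shift s c (suc d) m = begin
  maxEdges s c (suc d + m)    ≤⟨ maxEdges-suc s c (d + m) ⟩
  maxEdges s (suc c) (d + m)  ≤⟨ maxEdges-shift s (suc c) d m ⟩
  maxEdges s (d + suc c) m    ≡⟨ cong (λ x → maxEdges s x m) (+-suc d c) ⟩
  maxEdges s (suc d + c) m    ∎
  where open ≤-Reasoning

maxEdges-moveToCore : ∀ s {c k t m} → c ≤ k → k ≤ t → c + m ≡ t → maxEdges s c m ≤ maxEdges s k (t ∸ k)
maxEdges-moveToCore s {c} {m = m} c≤k k≤t c+m≡t with m≤n⇒∃[o]m+o≡n c≤k | m≤n⇒∃[o]m+o≡n k≤t
... | d , refl | e , refl = begin
  maxEdges s c m                            ≡⟨ cong (maxEdges s c) (+-cancelˡ-≡ c m (d + e) (trans c+m≡t (+-assoc c d e))) ⟩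
  maxEdges s c (d + e)                      ≤⟨ maxEdges-shift s c d e ⟩
  maxEdges s (d + c) e                      ≡⟨ cong₂ (maxEdges s) (+-comm d c) (sym (m+n∸m≡n (c + d) e)) ⟩
  maxEdges s (c + d) (c + d + e ∸ (c + d))  ∎
  where open ≤-Reasoning

fkst≡maxEdges : ∀ k s t → fkst k s t ≡ maxEdges s k (t ∸ k)
fkst≡maxEdges k zero t = begin
  k C 2 + k * m + 0 + m C 2      ≡⟨ cong (_+ m C 2) (+-identityʳ (k C 2 + k * m)) ⟩
  k C 2 + k * m + m C 2          ≡⟨ cong₂ (λ x y → x + k * m + y) (C2≡choose2 k) (C2≡choose2 m) ⟩
  choose2 k + k * m + choose2 m  ∎
  where
  open ≡-Reasoning
  m : ℕ
  m = t ∸ k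
fkst≡maxEdges k s@(suc _) t = begin
  k C 2 + k * m + q * (s C 2) + (m ∸ q * s) C 2              ≡⟨ +-assoc (k C 2 + k * m) _ _ ⟩
  k C 2 + k * m + (q * (s C 2) + (m ∸ q * s) C 2)            ≡⟨ cong₂ (λ x y → x + k * m + y) (C2≡choose2 k)
                                                                  (cong₂ (λ x y → q * x + y) (C2≡choose2 s) (C2≡choose2 (m ∸ q * s))) ⟩
  choose2 k + k * m + (q * choose2 s + choose2 (m ∸ q * s))  ∎
  where
  open ≡-Reasoning
  m q : ℕ
  m = t ∸ k
  q = m / s

∑-mono-≤ : ∀ {n} {f g : Vector ℕ n} → (∀ i → f i ≤ g i) → sum f ≤ sum g
∑-mono-≤ {zero}  f≤g = z≤n
∑-mono-≤ {suc n} f≤g = +-mono-≤ (f≤g zero) (∑-mono-≤ (f≤g ∘ suc))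

∑1≡n : ∀ n → ∑[ i < n ] 1 ≡ n
∑1≡n zero    = refl
∑1≡n (suc n) = cong suc (∑1≡n n)

𝟙 : Bool → ℕ
𝟙 true  = 1
𝟙 false = 0

∑𝟙≤∑ : ∀ {n} (f : Vector Bool n) (g : Vector ℕ n) → (∀ i → f i ≡ true → 1 ≤ g i) → sum (𝟙 ∘ f) ≤ sum g
∑𝟙≤∑ f g true⇒1≤g = ∑-mono-≤ (λ i → 𝟙≤ (f i) (true⇒1≤g i))
  where
  𝟙≤ : ∀ {x} b → (b ≡ true → 1 ≤ x) → 𝟙 b ≤ x
  𝟙≤ true  1≤x = 1≤x refl
  𝟙≤ false _   = z≤n

∑-injective≤1 : ∀ {V : Set} {n} {ψ : Fin n → V} → Injective _≡_ _≡_ ψ → (e : V → ℕ) (w : V) →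
                (∀ v → e v ≤ 1) → (∀ v → 0 < e v → v ≡ w) → sum (e ∘ ψ) ≤ 1
∑-injective≤1 {n = zero}          _     _ _ _   _      = z≤n
∑-injective≤1 {n = suc n} {ψ} ψ-inj e w e≤1 e>0⇒≡w with e (ψ zero) in e₀
... | zero  = ∑-injective≤1 (Fin.suc-injective ∘ ψ-inj) e w e≤1 e>0⇒≡w
... | suc x = begin
  suc x + sum (e ∘ ψ ∘ suc)  ≡⟨ cong (suc x +_) (trans (sum-cong-≗ rest≡0) (sum-replicate-zero n)) ⟩
  suc x + 0                  ≡⟨ +-identityʳ (suc x) ⟩
  suc x                      ≡⟨ e₀ ⟨
  e (ψ zero)                 ≤⟨ e≤1 (ψ zero) ⟩
  1                          ∎
  where
  open ≤-Reasoning
  ψ₀≡w : ψ zero ≡ w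
  ψ₀≡w = e>0⇒≡w (ψ zero) (subst (0 <_) (sym e₀) z<s)
  rest≡0 : ∀ j → e (ψ (suc j)) ≡ 0
  rest≡0 j = n≤0⇒n≡0 (≮⇒≥ λ e>0 → Fin.0≢1+n (ψ-inj (trans ψ₀≡w (sym (e>0⇒≡w _ e>0)))))

∑-injective≤ : ∀ {V : Set} {n m} {ψ : Fin n → V} → Injective _≡_ _≡_ ψ → (e : Fin m → V → ℕ) (w : Fin m → V) →
               (∀ x v → e x v ≤ 1) → (∀ x v → 0 < e x v → v ≡ w x) → ∑[ j < n ] ∑[ x < m ] e x (ψ j) ≤ m
∑-injective≤ {n = n} {m} {ψ} ψ-inj e w e≤1 e>0⇒≡w = begin
  ∑[ j < n ] ∑[ x < m ] e x (ψ j)  ≡⟨ ∑-comm (λ j x → e x (ψ j)) ⟩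
  ∑[ x < m ] ∑[ j < n ] e x (ψ j)  ≤⟨ ∑-mono-≤ (λ x → ∑-injective≤1 ψ-inj (e x) (w x) (e≤1 x) (e>0⇒≡w x)) ⟩
  ∑[ x < m ] 1                     ≡⟨ ∑1≡n m ⟩
  m                                ∎
  where open ≤-Reasoning

δ : ∀ {n} → Fin n → Fin n → ℕ
δ i j = 𝟙 (does (i Fin.≟ j))

δ-refl : ∀ {n} (i : Fin n) → δ i i ≡ 1
δ-refl i with i Fin.≟ i
... | yes _  = refl
... | no i≢i = contradiction refl i≢i

δ≤1 : ∀ {n} (i j : Fin n) → δ i j ≤ 1
δ≤1 i j with does (i Fin.≟ j)
... | true  = ≤-refl
... | false = z≤n

δ>0⇒≡ : ∀ {n} (i j : Fin n) → 0 < δ i j → i ≡ j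
δ>0⇒≡ i j δ>0 with i Fin.≟ j
... | yes i≡j = i≡j

∑δ*≡ : ∀ {n} (i : Fin n) (h : Vector ℕ n) → ∑[ j < n ] (δ j i * h j) ≡ h i
∑δ*≡ {suc n} zero    h = trans (cong (h zero + 0 +_) (sum-replicate-zero n)) (trans (+-identityʳ _) (+-identityʳ _))
∑δ*≡ {suc n} (suc i) h = ∑δ*≡ i (h ∘ suc)

∑δ≡1 : ∀ {n} (i : Fin n) → ∑[ j < n ] δ j i ≡ 1
∑δ≡1 i = trans (sum-cong-≗ (λ j → sym (*-identityʳ (δ j i)))) (∑δ*≡ i (λ _ → 1))

count : {A : Set} → (A → Bool) → List A → ℕ
count f []       = 0
count f (x ∷ xs) = 𝟙 (f x) + count f xs

module _ {A : Set} {ℓ} {P : A → Set ℓ} (P? : Decidable P) where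

  length-filter≡count : ∀ xs → length (filter P? xs) ≡ count (does ∘ P?) xs
  length-filter≡count []       = refl
  length-filter≡count (x ∷ xs) with does (P? x)
  ... | true  = cong suc (length-filter≡count xs)
  ... | false = length-filter≡count xs

  count-filter : ∀ f xs → count f (filter P? xs) ≡ count (λ x → does (P? x) ∧ f x) xs
  count-filter f []       = refl
  count-filter f (x ∷ xs) with does (P? x)
  ... | true  = cong (𝟙 (f x) +_) (count-filter f xs)
  ... | false = count-filter f xs

count-++ : ∀ {A : Set} (f : A → Bool) xs ys → count f (xs ++ ys) ≡ count f xs + count f ys
count-++ f []       ys = refl
count-++ f (x ∷ xs) ys = trans (cong (𝟙 (f x) +_) (count-++ f xs ys)) (sym (+-assoc (𝟙 (f x)) _ _))

count-tabulate : ∀ {A : Set} (f : A → Bool) {n} (g : Fin n → A) → count f (tabulate g) ≡ ∑[ i < n ] 𝟙 (f (g i))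
count-tabulate f {zero}  g = refl
count-tabulate f {suc n} g = cong (𝟙 (f (g zero)) +_) (count-tabulate f (g ∘ suc))

count-concat-tabulate : ∀ {A : Set} (f : A → Bool) {n} (F : Fin n → List A) →
                        count f (concat (tabulate F)) ≡ ∑[ i < n ] count f (F i)
count-concat-tabulate f {zero}  F = refl
count-concat-tabulate f {suc n} F =
  trans (count-++ f (F zero) _) (cong (count f (F zero) +_) (count-concat-tabulate f (F ∘ suc)))

ascendingPairs : ∀ n → (Fin n → Fin n → Bool) → ℕ
ascendingPairs n P = ∑[ i < n ] ∑[ j < n ] 𝟙 (does (toℕ i <? toℕ j) ∧ P i j)

edgeCount≡ascendingPairs : ∀ {n} (H : Graph n) → edgeCount H ≡ ascendingPairs n (adj H)
edgeCount≡ascendingPairs {n} H = begin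
  edgeCount H                                        ≡⟨ length-filter≡count isEdge? (filter ascending? pairs) ⟩
  count (does ∘ isEdge?) (filter ascending? pairs)   ≡⟨ count-filter ascending? (does ∘ isEdge?) pairs ⟩
  count edgeᵇ (concat (map row (tabulate id)))       ≡⟨ cong (count edgeᵇ ∘ concat) (map-tabulate id row) ⟩
  count edgeᵇ (concat (tabulate row))                ≡⟨ count-concat-tabulate edgeᵇ row ⟩
  ∑[ i < n ] count edgeᵇ (row i)                     ≡⟨ sum-cong-≗ count-row ⟩
  ascendingPairs n (adj H)                           ∎
  where
  open ≡-Reasoning
  row : Fin n → List (Fin n × Fin n)
  row i = map (i ,_) (allFin n)
  pairs : List (Fin n × Fin n)
  pairs = concat (map row (allFin n))
  isEdge? : Decidable {A = Fin n × Fin n} λ (i , j) → adj H i j ≡ true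
  isEdge? (i , j) = adj H i j Bool.≟ true
  ascending? : Decidable {A = Fin n × Fin n} λ (i , j) → toℕ i < toℕ j
  ascending? (i , j) = toℕ i <? toℕ j
  edgeᵇ : Fin n × Fin n → Bool
  edgeᵇ p = does (ascending? p) ∧ does (isEdge? p)
  ≟true : ∀ b → does (b Bool.≟ true) ≡ b
  ≟true true  = refl
  ≟true false = refl
  count-row : ∀ i → count edgeᵇ (row i) ≡ ∑[ j < n ] 𝟙 (does (toℕ i <? toℕ j) ∧ adj H i j)
  count-row i = begin
    count edgeᵇ (map (i ,_) (tabulate id))            ≡⟨ cong (count edgeᵇ) (map-tabulate id (i ,_)) ⟩
    count edgeᵇ (tabulate (i ,_))                     ≡⟨ count-tabulate edgeᵇ (i ,_) ⟩
    ∑[ j < n ] 𝟙 (edgeᵇ (i , j))                      ≡⟨ sum-cong-≗ (λ j → cong (λ b → 𝟙 (does (toℕ i <? toℕ j) ∧ b)) (≟true (adj H i j))) ⟩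
    ∑[ j < n ] 𝟙 (does (toℕ i <? toℕ j) ∧ adj H i j)  ∎

module Profile {k r s : ℕ} where

  inCore : SVert k r s → ℕ
  inCore (inj₁ _) = 1
  inCore (inj₂ _) = 0

  inParts : SVert k r s → ℕ
  inParts (inj₁ _) = 0
  inParts (inj₂ _) = 1

  inPart : Fin r → SVert k r s → ℕ
  inPart i (inj₁ _)       = 0
  inPart i (inj₂ (j , _)) = δ i j

  module _ {n : ℕ} (ψ : Fin n → SVert k r s) where

    coreSize : ℕ
    coreSize = ∑[ j < n ] inCore (ψ j)

    partsSize : ℕ
    partsSize = ∑[ j < n ] inParts (ψ j)

    partSize : Fin r → ℕ
    partSize i = ∑[ j < n ] inPart i (ψ j)

  coreSize+partsSize≡n : ∀ {n} (ψ : Fin n → SVert k r s) → coreSize ψ + partsSize ψ ≡ n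
  coreSize+partsSize≡n {n} ψ = begin
    coreSize ψ + partsSize ψ                   ≡⟨ ∑-distrib-+ (inCore ∘ ψ) (inParts ∘ ψ) ⟨
    ∑[ j < n ] (inCore (ψ j) + inParts (ψ j))  ≡⟨ sum-cong-≗ (inCore+inParts≡1 ∘ ψ) ⟩
    ∑[ j < n ] 1                               ≡⟨ ∑1≡n n ⟩
    n                                          ∎
    where
    open ≡-Reasoning
    inCore+inParts≡1 : ∀ v → inCore v + inParts v ≡ 1
    inCore+inParts≡1 (inj₁ _) = refl
    inCore+inParts≡1 (inj₂ _) = refl

  partsSize≡∑partSize : ∀ {n} (ψ : Fin n → SVert k r s) → partsSize ψ ≡ ∑[ i < r ] partSize ψ i
  partsSize≡∑partSize {n} ψ = trans (sum-cong-≗ (inParts≡∑inPart ∘ ψ)) (∑-comm (λ j i → inPart i (ψ j)))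
    where
    inParts≡∑inPart : ∀ v → inParts v ≡ ∑[ i < r ] inPart i v
    inParts≡∑inPart (inj₁ _)       = sym (sum-replicate-zero r)
    inParts≡∑inPart (inj₂ (j , _)) = sym (∑δ≡1 j)

  coreSize≤k : ∀ {n} {ψ : Fin n → SVert k r s} → Injective _≡_ _≡_ ψ → coreSize ψ ≤ k
  coreSize≤k {n} {ψ} ψ-inj = begin
    coreSize ψ                            ≡⟨ sum-cong-≗ (inCore≡∑atCore ∘ ψ) ⟩
    ∑[ j < n ] ∑[ c < k ] atCore c (ψ j)  ≤⟨ ∑-injective≤ ψ-inj atCore inj₁ atCore≤1 atCore>0⇒≡ ⟩
    k                                     ∎
    where
    open ≤-Reasoning
    atCore : Fin k → SVert k r s → ℕ
    atCore c (inj₁ c′) = δ c c′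
    atCore c (inj₂ _)  = 0
    inCore≡∑atCore : ∀ v → inCore v ≡ ∑[ c < k ] atCore c v
    inCore≡∑atCore (inj₁ c′) = sym (∑δ≡1 c′)
    inCore≡∑atCore (inj₂ _)  = sym (sum-replicate-zero k)
    atCore≤1 : ∀ c v → atCore c v ≤ 1
    atCore≤1 c (inj₁ c′) = δ≤1 c c′
    atCore≤1 c (inj₂ _)  = z≤n
    atCore>0⇒≡ : ∀ c v → 0 < atCore c v → v ≡ inj₁ c
    atCore>0⇒≡ c (inj₁ c′) δ>0 = cong inj₁ (sym (δ>0⇒≡ c c′ δ>0))

  partSize≤s : ∀ {n} {ψ : Fin n → SVert k r s} → Injective _≡_ _≡_ ψ → ∀ i → partSize ψ i ≤ s
  partSize≤s {n} {ψ} ψ-inj i = begin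
    partSize ψ i                          ≡⟨ sum-cong-≗ (inPart≡∑atPart ∘ ψ) ⟩
    ∑[ j < n ] ∑[ x < s ] atPart x (ψ j)  ≤⟨ ∑-injective≤ ψ-inj atPart (λ x → inj₂ (i , x)) atPart≤1 atPart>0⇒≡ ⟩
    s                                     ∎
    where
    open ≤-Reasoning
    atPart : Fin s → SVert k r s → ℕ
    atPart x (inj₁ _)       = 0
    atPart x (inj₂ (j , y)) = δ i j * δ x y
    inPart≡∑atPart : ∀ v → inPart i v ≡ ∑[ x < s ] atPart x v
    inPart≡∑atPart (inj₁ _)       = sym (sum-replicate-zero s)
    inPart≡∑atPart (inj₂ (j , y)) = begin-equality
      δ i j                       ≡⟨ *-identityʳ (δ i j) ⟨
      δ i j * 1                   ≡⟨ cong (δ i j *_) (∑δ≡1 y) ⟨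
      δ i j * ∑[ x < s ] δ x y    ≡⟨ *-distribˡ-sum (δ i j) (λ x → δ x y) ⟩
      ∑[ x < s ] (δ i j * δ x y)  ∎
    atPart≤1 : ∀ x v → atPart x v ≤ 1
    atPart≤1 x (inj₁ _)       = z≤n
    atPart≤1 x (inj₂ (j , y)) = *-mono-≤ (δ≤1 i j) (δ≤1 x y)
    atPart>0⇒≡ : ∀ x v → 0 < atPart x v → v ≡ inj₂ (i , x)
    atPart>0⇒≡ x (inj₂ (j , y)) δδ>0 with i Fin.≟ j | x Fin.≟ y
    ... | yes refl | yes refl = refl

  ∑choose2-bump : ∀ (i : Fin r) (b : Vector ℕ r) →
                  ∑[ j < r ] choose2 (δ j i + b j) ≡ ∑[ j < r ] choose2 (b j) + b i
  ∑choose2-bump i b = begin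
    ∑[ j < r ] choose2 (δ j i + b j)                     ≡⟨ sum-cong-≗ (λ j → choose2-𝟙+ (does (j Fin.≟ i)) (b j)) ⟩
    ∑[ j < r ] (choose2 (b j) + δ j i * b j)             ≡⟨ ∑-distrib-+ (choose2 ∘ b) (λ j → δ j i * b j) ⟩
    ∑[ j < r ] choose2 (b j) + ∑[ j < r ] (δ j i * b j)  ≡⟨ cong (∑[ j < r ] choose2 (b j) +_) (∑δ*≡ i b) ⟩
    ∑[ j < r ] choose2 (b j) + b i                       ∎
    where
    open ≡-Reasoning
    choose2-𝟙+ : ∀ x m → choose2 (𝟙 x + m) ≡ choose2 m + 𝟙 x * m
    choose2-𝟙+ true  m = trans (+-comm m (choose2 m)) (cong (choose2 m +_) (sym (+-identityʳ m)))
    choose2-𝟙+ false m = sym (+-identityʳ (choose2 m))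

  pairBound : ∀ {n} → (Fin n → SVert k r s) → ℕ
  pairBound ψ = choose2 (coreSize ψ) + coreSize ψ * partsSize ψ + ∑[ i < r ] choose2 (partSize ψ i)

  neighbourWeight : SVert k r s → SVert k r s → ℕ
  neighbourWeight (inj₁ _)       w = inCore w + inParts w
  neighbourWeight (inj₂ (i , _)) w = inCore w + inPart i w

  SAdj⇒1≤neighbourWeight : ∀ v w → SAdj v w → 1 ≤ neighbourWeight v w
  SAdj⇒1≤neighbourWeight (inj₁ _)       (inj₁ _)       _         = ≤-refl
  SAdj⇒1≤neighbourWeight (inj₁ _)       (inj₂ _)       _         = ≤-refl
  SAdj⇒1≤neighbourWeight (inj₂ _)       (inj₁ _)       _         = ≤-refl
  SAdj⇒1≤neighbourWeight (inj₂ (i , _)) (inj₂ (j , _)) (refl , _) = ≤-reflexive (sym (δ-refl i))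

  pairBound-suc : ∀ {n} (ψ : Fin (suc n) → SVert k r s) →
                  ∑[ j < n ] neighbourWeight (ψ zero) (ψ (suc j)) + pairBound (ψ ∘ suc) ≡ pairBound ψ
  pairBound-suc {n} ψ with ψ zero
  ... | inj₁ _ = begin
    ∑[ j < n ] (inCore (ψ′ j) + inParts (ψ′ j)) + (choose2 a + a * B + S)
      ≡⟨ cong (_+ (choose2 a + a * B + S)) (∑-distrib-+ (inCore ∘ ψ′) (inParts ∘ ψ′)) ⟩
    a + B + (choose2 a + a * B + S)
      ≡⟨ solve 4 (λ a b c s → a :+ b :+ (c :+ a :* b :+ s) := a :+ c :+ (b :+ a :* b) :+ s) refl a B (choose2 a) S ⟩
    choose2 (suc a) + suc a * B + S
      ∎
    where
    open ≡-Reasoning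
    ψ′ : Fin n → SVert k r s
    ψ′ = ψ ∘ suc
    a B S : ℕ
    a = coreSize ψ′
    B = partsSize ψ′
    S = ∑[ i < r ] choose2 (partSize ψ′ i)
  ... | inj₂ (i , _) = begin
    ∑[ j < n ] (inCore (ψ′ j) + inPart i (ψ′ j)) + (choose2 a + a * B + S)
      ≡⟨ cong (_+ (choose2 a + a * B + S)) (∑-distrib-+ (inCore ∘ ψ′) (inPart i ∘ ψ′)) ⟩
    a + b i + (choose2 a + a * B + S)
      ≡⟨ solve 5 (λ a bi c ab s → a :+ bi :+ (c :+ ab :+ s) := c :+ (a :+ ab) :+ (s :+ bi)) refl a (b i) (choose2 a) (a * B) S ⟩
    choose2 a + (a + a * B) + (S + b i)
      ≡⟨ cong₂ (λ x y → choose2 a + x + y) (*-suc a B) (∑choose2-bump i b) ⟨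
    choose2 a + a * suc B + ∑[ j < r ] choose2 (δ j i + b j)
      ∎
    where
    open ≡-Reasoning
    ψ′ : Fin n → SVert k r s
    ψ′ = ψ ∘ suc
    b : Fin r → ℕ
    b = partSize ψ′
    a B S : ℕ
    a = coreSize ψ′
    B = partsSize ψ′
    S = ∑[ i < r ] choose2 (b i)

  -- Vertex zero precedes all others, so ascendingPairs (suc n) P unfolds to the
  -- number of later neighbours of vertex zero plus the ascending pairs of the rest.
  ascendingPairs≤pairBound : ∀ {n} (P : Fin n → Fin n → Bool) (ψ : Fin n → SVert k r s) →
                             (∀ i j → P i j ≡ true → SAdj (ψ i) (ψ j)) → ascendingPairs n P ≤ pairBound ψ
  ascendingPairs≤pairBound {zero}  P ψ P⇒adj = z≤n
  ascendingPairs≤pairBound {suc n} P ψ P⇒adj = begin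
    ∑[ j < n ] 𝟙 (P zero (suc j)) + ascendingPairs n (λ i j → P (suc i) (suc j))
      ≤⟨ +-mono-≤ (∑𝟙≤∑ (P zero ∘ suc) _ (λ j → SAdj⇒1≤neighbourWeight (ψ zero) (ψ (suc j)) ∘ P⇒adj zero (suc j)))
                  (ascendingPairs≤pairBound _ (ψ ∘ suc) (λ i j → P⇒adj (suc i) (suc j))) ⟩
    ∑[ j < n ] neighbourWeight (ψ zero) (ψ (suc j)) + pairBound (ψ ∘ suc)
      ≡⟨ pairBound-suc ψ ⟩
    pairBound ψ
      ∎
    where open ≤-Reasoning

  pairBound≤maxEdges : ∀ {n} {ψ : Fin n → SVert k r s} → Injective _≡_ _≡_ ψ →
                       pairBound ψ ≤ maxEdges s (coreSize ψ) (partsSize ψ)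
  pairBound≤maxEdges {ψ = ψ} ψ-inj = begin
    choose2 a + a * B + ∑[ i < r ] choose2 (partSize ψ i)
      ≤⟨ +-monoʳ-≤ (choose2 a + a * B) (∑choose2≤packedPairs s (partSize ψ) (partSize≤s ψ-inj)) ⟩
    choose2 a + a * B + packedPairs s (∑[ i < r ] partSize ψ i)
      ≡⟨ cong (λ m → choose2 a + a * B + packedPairs s m) (partsSize≡∑partSize ψ) ⟨
    maxEdges s a B
      ∎
    where
    open ≤-Reasoning
    a B : ℕ
    a = coreSize ψ
    B = partsSize ψ

open Profile

-- The hypothesis t ≤ k + r s only guarantees that such an H can exist; the bound does not need it.
lemma3p2 : (k r s t : ℕ) → k ≤ t → t ≤ k + r * s →
    (H : Graph t) → IsSubgraphOfS k r s H → edgeCount H ≤ fkst k s t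
lemma3p2 k r s t k≤t _ H (φ , φ-inj , φ-hom) = begin
  edgeCount H                             ≡⟨ edgeCount≡ascendingPairs H ⟩
  ascendingPairs t (adj H)                ≤⟨ ascendingPairs≤pairBound (adj H) φ φ-hom ⟩
  pairBound φ                             ≤⟨ pairBound≤maxEdges φ-inj ⟩
  maxEdges s (coreSize φ) (partsSize φ)   ≤⟨ maxEdges-moveToCore s (coreSize≤k φ-inj) k≤t (coreSize+partsSize≡n φ) ⟩
  maxEdges s k (t ∸ k)                    ≡⟨ fkst≡maxEdges k s t ⟨
  fkst k s t                              ∎
  where open ≤-Reasoning
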